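{- For $n\ge 1$, the friendship graph $F_n$ satisfies $\nu^*(F_n)=17n^2+n$.
   Context: The friendship graph $F_n$ consists of $n$ copies of the triangle $C_3$ sharing a single common vertex (and otherwise disjoint). For a finite simple graph $G=(V,E)$ with $p=|V|$, $q=|E|$, $\ell=p+q$, a construction sequence (c-sequence) for $G$ is a bijection $x:\{1,\dots,\ell\}\to V\sqcup E$ such that for every edge $e=uw$, $x^{ -1}(e)>\max\{x^{ -1}(u),x^{ -1}(w)\}$. The cost of an edge $e=uw$ in $x$ is $\nu(e,x)=(x^{ -1}(e)-x^{ -1}(u))+(x^{ -1}(e)-x^{ -1}(w))$, and the cost of $x$ is $\nu(x)=\sum_{e\in E}\nu(e,x)$. The max cost of $G$ is $\nu^*(G)=\max\nu(x)$ over all c-sequences $x$ for $G$. -}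

module Defs where

open import Data.Nat using (ℕ; zero; suc; _+_; _*_; _∸_; _<_)
open import Data.Fin using (Fin; toℕ; zero; suc)
open import Data.Fin.Properties using (_≟_)
open import Data.List using (map; allFin)
open import Data.Nat.ListAction using (sum)
open import Data.Product using (_×_; _,_; Σ; proj₁; proj₂)
open import Data.Sum using (_⊎_; inj₁; inj₂)
open import Data.Unit using (⊤; tt)
open import Data.Bool using (Bool; true; false)
open import Function.Bundles using (_↔_; Inverse)
open import Relation.Binary.PropositionalEquality using (_≡_; _≢_; refl; cong)

record Graph : Set₁ where
  field
    V    : Set
    E    : Set
    ends : E → V × V
    loopless : ∀ e → proj₁ (ends e) ≢ proj₂ (ends e)
    noMulti  : ∀ e f → (ends e ≡ ends f ⊎ ends e ≡ (proj₂ (ends f) , proj₁ (ends f))) → e ≡ f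

open Graph public

-- A construction sequence of length ℓ: a bijection x : Fin ℓ → V ⊔ E
-- (positions are 0-based; this does not affect costs), such that every edge
-- comes strictly after both of its endpoints.  The existence of the
-- bijection forces ℓ = |V| + |E|.
record CSeq (G : Graph) (ℓ : ℕ) : Set where
  field
    x     : Fin ℓ ↔ (V G ⊎ E G)
    order : ∀ (e : E G) →
      toℕ (Inverse.from x (inj₁ (proj₁ (ends G e)))) < toℕ (Inverse.from x (inj₂ e)) ×
      toℕ (Inverse.from x (inj₁ (proj₂ (ends G e)))) < toℕ (Inverse.from x (inj₂ e))

open CSeq public

pos : ∀ {G ℓ} → CSeq G ℓ → V G ⊎ E G → ℕ
pos s a = toℕ (Inverse.from (x s) a)

edgeCost : ∀ {G ℓ} → CSeq G ℓ → E G → ℕ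
edgeCost {G} s e =
  (pos s (inj₂ e) ∸ pos s (inj₁ (proj₁ (ends G e)))) +
  (pos s (inj₂ e) ∸ pos s (inj₁ (proj₂ (ends G e))))

-- ν(x) = sum of edge costs, summing over positions holding an edge
-- (each edge occupies exactly one position).
costAt : ∀ {G ℓ} → CSeq G ℓ → Fin ℓ → ℕ
costAt s k with Inverse.to (x s) k
... | inj₁ _ = 0
... | inj₂ e = edgeCost s e

cost : ∀ {G ℓ} → CSeq G ℓ → ℕ
cost {ℓ = ℓ} s = sum (map (costAt s) (allFin ℓ))

MaxCost : Graph → ℕ → Set
MaxCost G m =
  (Σ ℕ λ ℓ → Σ (CSeq G ℓ) λ s → cost s ≡ m) ×
  (∀ ℓ (s : CSeq G ℓ) → cost s Data.Nat.≤ m)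

-- Friendship graph F_n: centre c = inj₁ tt, triangle i has outer vertices
-- (i,false),(i,true); edges (i,0)=c-(i,false), (i,1)=c-(i,true),
-- (i,2)=(i,false)-(i,true).
FV : ℕ → Set
FV n = ⊤ ⊎ (Fin n × Bool)

FE : ℕ → Set
FE n = Fin n × Fin 3

Fends : ∀ n → FE n → FV n × FV n
Fends n (i , zero)             = inj₁ tt , inj₂ (i , false)
Fends n (i , suc zero)         = inj₁ tt , inj₂ (i , true)
Fends n (i , suc (suc zero))   = inj₂ (i , false) , inj₂ (i , true)

Floopless : ∀ n e → proj₁ (Fends n e) ≢ proj₂ (Fends n e)
Floopless n (i , zero) ()
Floopless n (i , suc zero) ()
Floopless n (i , suc (suc zero)) ()

FnoMulti : ∀ n e f →
  (Fends n e ≡ Fends n f ⊎ Fends n e ≡ (proj₂ (Fends n f) , proj₁ (Fends n f))) → e ≡ f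
FnoMulti n (i , zero)             (j , zero)             (inj₁ refl) = refl
FnoMulti n (i , suc zero)         (j , suc zero)         (inj₁ refl) = refl
FnoMulti n (i , suc (suc zero))   (j , suc (suc zero))   (inj₁ refl) = refl
FnoMulti n (i , zero)             (j , zero)             (inj₂ ())
FnoMulti n (i , zero)             (j , suc zero)         (inj₁ ())
FnoMulti n (i , zero)             (j , suc zero)         (inj₂ ())
FnoMulti n (i , zero)             (j , suc (suc zero))   (inj₁ ())
FnoMulti n (i , zero)             (j , suc (suc zero))   (inj₂ ())
FnoMulti n (i , suc zero)         (j , zero)             (inj₁ ())
FnoMulti n (i , suc zero)         (j , zero)             (inj₂ ())
FnoMulti n (i , suc zero)         (j , suc zero)         (inj₂ ())
FnoMulti n (i , suc zero)         (j , suc (suc zero))   (inj₁ ())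
FnoMulti n (i , suc zero)         (j , suc (suc zero))   (inj₂ ())
FnoMulti n (i , suc (suc zero))   (j , zero)             (inj₁ ())
FnoMulti n (i , suc (suc zero))   (j , zero)             (inj₂ ())
FnoMulti n (i , suc (suc zero))   (j , suc zero)         (inj₁ ())
FnoMulti n (i , suc (suc zero))   (j , suc zero)         (inj₂ ())
FnoMulti n (i , suc (suc zero))   (j , suc (suc zero))   (inj₂ ())

Friendship : ℕ → Graph
Friendship n = record
  { V = FV n ; E = FE n ; ends = Fends n
  ; loopless = Floopless n ; noMulti = FnoMulti n }

{-# OPTIONS --safe #-}
-- Since every edge e = uw comes after its endpoints, ν(e) + x⁻¹(u) + x⁻¹(w) = 2 x⁻¹(e).  Summing
-- over the three edges of each triangle and then over the triangles gives ν(x) + 2 (n c + O) = 2 E,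
-- where c is the position of the centre, O the sum of the positions of the 2n outer vertices and E
-- that of the 3n edges.  With c + O + E = 0 + 1 + ⋯ + 5n = T(5n + 1), where T(m) = m(m − 1)/2,
--   ν(x) + 2 (n c + O) + 2 (c + O) = 2 T(5n + 1).
-- The 2n + 1 vertices occupy distinct positions, so c + O ≥ T(2n + 1), and n c ≥ c since n ≥ 1;
-- hence ν(x) ≤ 2 T(5n + 1) − 4 T(2n + 1) = 17n² + n.  Listing the centre, then the outer vertices,
-- then the edges gives c = 0 and c + O = T(2n + 1), so the bound is attained.

module Submission where

open import Defs
open import Data.Bool using (Bool; true; false; if_then_else_)
open import Data.Fin.Patterns using (0F; 1F; 2F)
open import Data.Fin using (Fin; zero; suc; toℕ; _↑ˡ_; _↑ʳ_; combine)
open import Data.Fin.Permutation using (↔⇒≡)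
open import Data.Fin.Properties
  using (1↔⊤; 2↔Bool; +↔⊎; *↔×; splitAt-↑ˡ; splitAt-↑ʳ; remQuot-combine; toℕ-↑ˡ; toℕ-↑ʳ; toℕ<n)
open import Data.List using ([]; _∷_; map; tabulate)
import Data.Nat.ListAction as List
open import Data.Nat using (ℕ; zero; suc; _+_; _*_; _∸_; _≤_; _<_; z≤n; >-nonZero)
open import Data.Nat.Properties
open import Algebra.Properties.CommutativeSemigroup +-commutativeSemigroup using (interchange)
open import Algebra.Properties.Semiring.Sum +-*-semiring
  using (sum; sum-syntax; sum-cong-≗; sum-permute; sum-replicate-zero; ∑-distrib-+; *-distribˡ-sum)
open import Data.Nat.Tactic.RingSolver using (solve)
open import Data.Product using (_×_; _,_; proj₁; proj₂)
open import Data.Product.Function.NonDependent.Propositional using (_×-↔_)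
open import Data.Sum using (_⊎_; inj₁; inj₂; [_,_]′)
open import Data.Sum.Function.Propositional using (_⊎-↔_)
open import Data.Unit using (tt)
open import Function using (_∘_; id; const)
open import Function.Bundles using (_↔_; Inverse)
open import Function.Properties.Inverse using (↔-refl; ↔-sym; ↔-trans)
open import Relation.Binary.PropositionalEquality
open Inverse using (to; from; strictlyInverseˡ; strictlyInverseʳ)

∑-const : ∀ n c → ∑[ i < n ] c ≡ n * c
∑-const zero    c = refl
∑-const (suc n) c = cong (c +_) (∑-const n c)

∑-↑ : ∀ m n (f : Fin (m + n) → ℕ) → sum f ≡ ∑[ i < m ] f (i ↑ˡ n) + ∑[ j < n ] f (m ↑ʳ j)
∑-↑ zero    n f = refl
∑-↑ (suc m) n f = trans (cong (f zero +_) (∑-↑ m n (f ∘ suc)))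
                        (sym (+-assoc (f zero) (∑[ i < m ] f (suc (i ↑ˡ n))) (∑[ j < n ] f (suc (m ↑ʳ j)))))

∑-combine : ∀ m n (f : Fin (m * n) → ℕ) → sum f ≡ ∑[ i < m ] ∑[ j < n ] f (combine i j)
∑-combine zero    n f = refl
∑-combine (suc m) n f =
  trans (∑-↑ n (m * n) f) (cong (∑[ j < n ] f (j ↑ˡ m * n) +_) (∑-combine m n (f ∘ (n ↑ʳ_))))

sum-map-tabulate : ∀ {m n} (f : Fin n → ℕ) (g : Fin m → Fin n) →
                   List.sum (map f (tabulate g)) ≡ ∑[ i < m ] f (g i)
sum-map-tabulate {zero}  f g = refl
sum-map-tabulate {suc m} f g = cong (f (g zero) +_) (sum-map-tabulate f (g ∘ suc))

triangular : ℕ → ℕ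
triangular zero    = 0
triangular (suc m) = m + triangular m

∑-toℕ : ∀ m → ∑[ i < m ] toℕ i ≡ triangular m
∑-toℕ zero    = refl
∑-toℕ (suc m) =
  trans (∑-distrib-+ {m} (const 1) toℕ) (cong₂ _+_ (trans (∑-const m 1) (*-identityʳ m)) (∑-toℕ m))

2*triangular[1+m]≡[1+m]*m : ∀ m → 2 * triangular (suc m) ≡ suc m * m
2*triangular[1+m]≡[1+m]*m zero    = refl
2*triangular[1+m]≡[1+m]*m (suc m) = begin
  2 * (suc m + triangular (suc m))       ≡⟨ *-distribˡ-+ 2 (suc m) (triangular (suc m)) ⟩
  2 * suc m + 2 * triangular (suc m)     ≡⟨ cong (2 * suc m +_) (2*triangular[1+m]≡[1+m]*m m) ⟩
  2 * suc m + suc m * m                  ≡⟨ solve (m ∷ []) ⟩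
  suc (suc m) * suc m                    ∎
  where open ≡-Reasoning

count : ∀ {ℓ} → (Fin ℓ → Bool) → ℕ
count {ℓ} b = ∑[ k < ℓ ] (if b k then 1 else 0)

∑-selected-suc : ∀ {ℓ} (b : Fin ℓ → Bool) →
  ∑[ k < ℓ ] (if b k then suc (toℕ k) else 0) ≡ count b + ∑[ k < ℓ ] (if b k then toℕ k else 0)
∑-selected-suc {ℓ} b = trans (sum-cong-≗ λ k → if-suc (b k) (toℕ k)) (∑-distrib-+ {ℓ} _ _)
  where
  if-suc : ∀ c t → (if c then suc t else 0) ≡ (if c then 1 else 0) + (if c then t else 0)
  if-suc true  t = refl
  if-suc false t = refl

triangular-count≤∑ : ∀ {ℓ} (b : Fin ℓ → Bool) →
  triangular (count b) ≤ ∑[ k < ℓ ] (if b k then toℕ k else 0)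
triangular-count≤∑ {zero}  b = z≤n
triangular-count≤∑ {suc ℓ} b with b zero
... | true  = ≤-trans (+-monoʳ-≤ (count (b ∘ suc)) (triangular-count≤∑ (b ∘ suc)))
                      (≤-reflexive (sym (∑-selected-suc (b ∘ suc))))
... | false = ≤-trans (triangular-count≤∑ (b ∘ suc))
                      (≤-trans (m≤n+m _ (count (b ∘ suc))) (≤-reflexive (sym (∑-selected-suc (b ∘ suc)))))

∑↔ : ∀ {m} {A : Set} → Fin m ↔ A → (A → ℕ) → ℕ
∑↔ {m} y F = ∑[ k < m ] F (to y k)

∑↔-unique : ∀ {m n} {A : Set} (y : Fin m ↔ A) (z : Fin n ↔ A) (F : A → ℕ) → ∑↔ y F ≡ ∑↔ z F
∑↔-unique y z F = sym (trans (sum-permute (F ∘ to z) (↔-trans y (↔-sym z)))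
                             (sum-cong-≗ (cong F ∘ strictlyInverseˡ z ∘ to y)))

∑↔-+↔⊎ : ∀ {m n} (F : Fin m ⊎ Fin n → ℕ) →
         ∑↔ +↔⊎ F ≡ ∑[ i < m ] F (inj₁ i) + ∑[ j < n ] F (inj₂ j)
∑↔-+↔⊎ {m} {n} F = trans (∑-↑ m n _) (cong₂ _+_ (sum-cong-≗ λ i → cong F (splitAt-↑ˡ m i n))
                                                (sum-cong-≗ λ j → cong F (splitAt-↑ʳ m n j)))

∑↔-*↔× : ∀ {m n} (F : Fin m × Fin n → ℕ) → ∑↔ *↔× F ≡ ∑[ i < m ] ∑[ j < n ] F (i , j)
∑↔-*↔× {m} {n} F =
  trans (∑-combine m n _) (sum-cong-≗ λ i → sum-cong-≗ λ j → cong F (remQuot-combine i j))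

∑↔-⊎ : ∀ {ℓ p q} {A B : Set} (w : Fin ℓ ↔ (A ⊎ B)) (y : Fin p ↔ A) (z : Fin q ↔ B)
       (F : A ⊎ B → ℕ) → ∑↔ w F ≡ ∑↔ y (F ∘ inj₁) + ∑↔ z (F ∘ inj₂)
∑↔-⊎ w y z F = trans (∑↔-unique w (↔-trans +↔⊎ (y ⊎-↔ z)) F) (∑↔-+↔⊎ (F ∘ to (y ⊎-↔ z)))

∑↔-position : ∀ {ℓ} {A : Set} (y : Fin ℓ ↔ A) → ∑↔ y (toℕ ∘ from y) ≡ triangular ℓ
∑↔-position {ℓ} y = trans (sum-cong-≗ (cong toℕ ∘ strictlyInverseʳ y)) (∑-toℕ ℓ)

triangular-count≤∑↔ : ∀ {ℓ} {A : Set} (y : Fin ℓ ↔ A) (b : A → Bool) →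
  triangular (∑↔ y (λ a → if b a then 1 else 0)) ≤ ∑↔ y (λ a → if b a then toℕ (from y a) else 0)
triangular-count≤∑↔ y b = subst (triangular (count (b ∘ to y)) ≤_)
  (sum-cong-≗ λ k → cong (λ j → if b (to y k) then toℕ j else 0) (sym (strictlyInverseʳ y k)))
  (triangular-count≤∑ (b ∘ to y))

edgeCost-ends : ∀ {G ℓ} (s : CSeq G ℓ) (e : E G) →
  edgeCost s e + (pos s (inj₁ (proj₁ (ends G e))) + pos s (inj₁ (proj₂ (ends G e)))) ≡ 2 * pos s (inj₂ e)
edgeCost-ends {G} s e = begin
  (t ∸ u) + (t ∸ w) + (u + w)  ≡⟨ interchange (t ∸ u) (t ∸ w) u w ⟩
  (t ∸ u + u) + (t ∸ w + w)    ≡⟨ cong₂ _+_ (m∸n+n≡m (<⇒≤ u<t)) (m∸n+n≡m (<⇒≤ w<t)) ⟩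
  t + t                        ≡⟨ cong (t +_) (+-identityʳ t) ⟨
  2 * t                        ∎
  where
  open ≡-Reasoning
  t = pos s (inj₂ e)
  u = pos s (inj₁ (proj₁ (ends G e)))
  w = pos s (inj₁ (proj₂ (ends G e)))
  u<t = proj₁ (order s e)
  w<t = proj₂ (order s e)

module _ {G : Graph} {ℓ p q} (s : CSeq G ℓ) (y : Fin p ↔ V G) (z : Fin q ↔ E G) where

  length≡ : ℓ ≡ p + q
  length≡ = ↔⇒≡ (↔-trans (x s) (↔-sym (↔-trans +↔⊎ (y ⊎-↔ z))))

  cost≡∑edgeCost : cost s ≡ ∑↔ z (edgeCost s)
  cost≡∑edgeCost = begin
    cost s                                          ≡⟨ sum-map-tabulate (costAt s) id ⟩
    ∑[ k < ℓ ] costAt s k                           ≡⟨ sum-cong-≗ costAt≡ ⟩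
    ∑↔ (x s) [ const 0 , edgeCost s ]′              ≡⟨ ∑↔-⊎ (x s) y z [ const 0 , edgeCost s ]′ ⟩
    ∑↔ y (const 0) + ∑↔ z (edgeCost s)              ≡⟨ cong (_+ ∑↔ z (edgeCost s)) (sum-replicate-zero p) ⟩
    ∑↔ z (edgeCost s)                               ∎
    where
    open ≡-Reasoning
    costAt≡ : ∀ k → costAt s k ≡ [ const 0 , edgeCost s ]′ (to (x s) k)
    costAt≡ k with to (x s) k
    ... | inj₁ _ = refl
    ... | inj₂ _ = refl

  ∑-positions : ∑↔ y (pos s ∘ inj₁) + ∑↔ z (pos s ∘ inj₂) ≡ triangular ℓ
  ∑-positions = trans (sym (∑↔-⊎ (x s) y z (pos s))) (∑↔-position (x s))

  triangular≤∑-vertexPositions : triangular p ≤ ∑↔ y (pos s ∘ inj₁)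
  triangular≤∑-vertexPositions = begin
    triangular p                                              ≡⟨ cong triangular vertexCount ⟨
    triangular (∑↔ (x s) (λ a → if isVertex a then 1 else 0)) ≤⟨ triangular-count≤∑↔ (x s) isVertex ⟩
    ∑↔ (x s) vertexPos                                        ≡⟨ ∑↔-⊎ (x s) y z vertexPos ⟩
    ∑V + ∑↔ z (const 0)                                       ≡⟨ cong (∑V +_) (sum-replicate-zero q) ⟩
    ∑V + 0                                                    ≡⟨ +-identityʳ ∑V ⟩
    ∑V                                                        ∎
    where
    open ≤-Reasoning
    ∑V = ∑↔ y (pos s ∘ inj₁)
    isVertex : V G ⊎ E G → Bool
    isVertex = [ const true , const false ]′
    vertexPos : V G ⊎ E G → ℕ
    vertexPos a = if isVertex a then pos s a else 0
    vertexCount : ∑↔ (x s) (λ a → if isVertex a then 1 else 0) ≡ p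
    vertexCount = trans (∑↔-⊎ (x s) y z (λ a → if isVertex a then 1 else 0))
      (trans (cong₂ _+_ (∑-const p 1) (sum-replicate-zero q)) (trans (+-identityʳ (p * 1)) (*-identityʳ p)))

vertices-first : ∀ {G p q} → Fin p ↔ V G → Fin q ↔ E G → CSeq G (p + q)
vertices-first {G} {p} {q} y z = record
  { x     = ↔-trans +↔⊎ (y ⊎-↔ z)
  ; order = λ e → vertex<edge _ e , vertex<edge _ e
  }
  where
  vertex<edge : ∀ v e → toℕ (from y v ↑ˡ q) < toℕ (p ↑ʳ from z e)
  vertex<edge v e = subst₂ _<_ (sym (toℕ-↑ˡ (from y v) q)) (sym (toℕ-↑ʳ p (from z e)))
                           (<-≤-trans (toℕ<n (from y v)) (m≤m+n p (toℕ (from z e))))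

vertices-first-vertexPositions : ∀ {G p q} (y : Fin p ↔ V G) (z : Fin q ↔ E G) →
  ∑↔ y (pos (vertices-first {G} y z) ∘ inj₁) ≡ triangular p
vertices-first-vertexPositions {q = q} y z =
  trans (sum-cong-≗ λ k → toℕ-↑ˡ (from y (to y k)) q) (∑↔-position y)

-- The trailing `+ 0`s are how ∑[ j < 3 ] unfolds.
edge-identities⇒triangle-identity : ∀ {c₀ c₁ c₂ a b d p₀ p₁ p₂} →
  c₀ + (a + b) ≡ 2 * p₀ → c₁ + (a + d) ≡ 2 * p₁ → c₂ + (b + d) ≡ 2 * p₂ →
  c₀ + (c₁ + (c₂ + 0)) + 2 * (a + (b + d)) ≡ 2 * (p₀ + (p₁ + (p₂ + 0)))
edge-identities⇒triangle-identity {c₀} {c₁} {c₂} {a} {b} {d} {p₀} {p₁} {p₂} h₀ h₁ h₂ = begin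
  c₀ + (c₁ + (c₂ + 0)) + 2 * (a + (b + d))            ≡⟨ solve (c₀ ∷ c₁ ∷ c₂ ∷ a ∷ b ∷ d ∷ []) ⟩
  (c₀ + (a + b)) + ((c₁ + (a + d)) + (c₂ + (b + d)))  ≡⟨ cong₂ _+_ h₀ (cong₂ _+_ h₁ h₂) ⟩
  2 * p₀ + (2 * p₁ + 2 * p₂)                          ≡⟨ solve (p₀ ∷ p₁ ∷ p₂ ∷ []) ⟩
  2 * (p₀ + (p₁ + (p₂ + 0)))                          ∎
  where open ≡-Reasoning

vertexEnum : ∀ n → Fin (1 + n * 2) ↔ FV n
vertexEnum n = ↔-trans +↔⊎ (1↔⊤ ⊎-↔ ↔-trans *↔× (↔-refl ×-↔ 2↔Bool))

edgeEnum : ∀ n → Fin (n * 3) ↔ FE n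
edgeEnum n = *↔×

∑-vertexEnum : ∀ n (F : FV n → ℕ) →
  ∑↔ (vertexEnum n) F ≡ F (inj₁ tt) + ∑[ i < n ] (F (inj₂ (i , false)) + F (inj₂ (i , true)))
∑-vertexEnum n F = trans (∑↔-+↔⊎ (F ∘ to (1↔⊤ ⊎-↔ ↔-trans *↔× (↔-refl ×-↔ 2↔Bool))))
  (cong₂ _+_ (+-identityʳ (F (inj₁ tt)))
             (trans (∑↔-*↔× (λ (i , r) → F (inj₂ (i , to 2↔Bool r))))
                    (sum-cong-≗ λ i → cong (F (inj₂ (i , false)) +_) (+-identityʳ (F (inj₂ (i , true)))))))

module FriendshipCSeq {n ℓ} (s : CSeq (Friendship n) ℓ) where

  centrePos : ℕ
  centrePos = pos s (inj₁ (inj₁ tt))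

  outerPos : Fin n → ℕ
  outerPos i = pos s (inj₁ (inj₂ (i , false))) + pos s (inj₁ (inj₂ (i , true)))

  outerPositions : ℕ
  outerPositions = ∑[ i < n ] outerPos i

  triangleCost edgePos : Fin n → ℕ
  triangleCost i = ∑[ j < 3 ] edgeCost s (i , j)
  edgePos i      = ∑[ j < 3 ] pos s (inj₂ (i , j))

  triangle-identity : ∀ i → triangleCost i + 2 * (centrePos + outerPos i) ≡ 2 * edgePos i
  triangle-identity i = edge-identities⇒triangle-identity
    {edgeCost s (i , 0F)} {edgeCost s (i , 1F)} {edgeCost s (i , 2F)}
    {centrePos} {pos s (inj₁ (inj₂ (i , false)))} {pos s (inj₁ (inj₂ (i , true)))}
    {pos s (inj₂ (i , 0F))} {pos s (inj₂ (i , 1F))} {pos s (inj₂ (i , 2F))}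
    (edgeCost-ends s (i , 0F)) (edgeCost-ends s (i , 1F)) (edgeCost-ends s (i , 2F))

  -- 2 (n · centrePos + outerPositions) is the degree-weighted sum of the vertex positions.
  degree-identity : ∑[ i < n ] triangleCost i + 2 * (n * centrePos + outerPositions)
                    ≡ 2 * ∑[ i < n ] edgePos i
  degree-identity = begin
    ∑C + 2 * (n * centrePos + outerPositions)
      ≡⟨ cong (λ t → ∑C + 2 * (t + outerPositions)) (∑-const n centrePos) ⟨
    ∑C + 2 * (∑[ i < n ] centrePos + outerPositions)
      ≡⟨ cong (λ t → ∑C + 2 * t) (∑-distrib-+ {n} (const centrePos) outerPos) ⟨
    ∑C + 2 * ∑[ i < n ] (centrePos + outerPos i)
      ≡⟨ cong (∑C +_) (*-distribˡ-sum 2 (λ i → centrePos + outerPos i)) ⟩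
    ∑C + ∑[ i < n ] (2 * (centrePos + outerPos i))
      ≡⟨ ∑-distrib-+ {n} triangleCost (λ i → 2 * (centrePos + outerPos i)) ⟨
    ∑[ i < n ] (triangleCost i + 2 * (centrePos + outerPos i))
      ≡⟨ sum-cong-≗ triangle-identity ⟩
    ∑[ i < n ] (2 * edgePos i)
      ≡⟨ *-distribˡ-sum 2 edgePos ⟨
    2 * ∑[ i < n ] edgePos i ∎
    where
    open ≡-Reasoning
    ∑C = ∑[ i < n ] triangleCost i

  cost-identity : cost s + (2 * (n * centrePos + outerPositions) + 2 * (centrePos + outerPositions))
                  ≡ 2 * triangular (1 + n * 2 + n * 3)
  cost-identity = begin
    cost s + (2 * A + 2 * B)     ≡⟨ cong (_+ (2 * A + 2 * B)) costs ⟩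
    ∑C + (2 * A + 2 * B)         ≡⟨ +-assoc ∑C (2 * A) (2 * B) ⟨
    ∑C + 2 * A + 2 * B           ≡⟨ cong (_+ 2 * B) degree-identity ⟩
    2 * ∑E + 2 * B               ≡⟨ *-distribˡ-+ 2 ∑E B ⟨
    2 * (∑E + B)                 ≡⟨ cong (2 *_) (trans (+-comm ∑E B) positions) ⟩
    2 * triangular ℓ             ≡⟨ cong (λ m → 2 * triangular m) (length≡ s y z) ⟩
    2 * triangular (1 + n * 2 + n * 3) ∎
    where
    open ≡-Reasoning
    y = vertexEnum n
    z = edgeEnum n
    A = n * centrePos + outerPositions
    B = centrePos + outerPositions
    ∑C = ∑[ i < n ] triangleCost i
    ∑E = ∑[ i < n ] edgePos i
    costs : cost s ≡ ∑C
    costs = trans (cost≡∑edgeCost s y z) (∑↔-*↔× (edgeCost s))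
    positions : B + ∑E ≡ triangular ℓ
    positions = trans (cong₂ _+_ (sym (∑-vertexEnum n (pos s ∘ inj₁))) (sym (∑↔-*↔× (pos s ∘ inj₂))))
                      (∑-positions s y z)

  triangular≤vertexPositions : triangular (1 + n * 2) ≤ centrePos + outerPositions
  triangular≤vertexPositions =
    subst (triangular (1 + n * 2) ≤_) (∑-vertexEnum n (pos s ∘ inj₁))
          (triangular≤∑-vertexPositions s (vertexEnum n) (edgeEnum n))

2*triangular[1+5n] : ∀ n → 2 * triangular (1 + n * 2 + n * 3)
                         ≡ 17 * (n * n) + n + (2 * triangular (1 + n * 2) + 2 * triangular (1 + n * 2))
2*triangular[1+5n] n = begin
  2 * triangular (suc (n * 2 + n * 3))     ≡⟨ 2*triangular[1+m]≡[1+m]*m (n * 2 + n * 3) ⟩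
  suc (n * 2 + n * 3) * (n * 2 + n * 3)    ≡⟨ solve (n ∷ []) ⟩
  17 * (n * n) + n + (suc (n * 2) * (n * 2) + suc (n * 2) * (n * 2))
    ≡⟨ cong (λ t → 17 * (n * n) + n + (t + t)) (2*triangular[1+m]≡[1+m]*m (n * 2)) ⟨
  17 * (n * n) + n + (2 * triangular (1 + n * 2) + 2 * triangular (1 + n * 2)) ∎
  where open ≡-Reasoning

canonical : ∀ n → CSeq (Friendship n) (1 + n * 2 + n * 3)
canonical n = vertices-first {Friendship n} (vertexEnum n) (edgeEnum n)

cost-canonical≡17n²+n : ∀ n → cost (canonical n) ≡ 17 * (n * n) + n
cost-canonical≡17n²+n n = +-cancelʳ-≡ (2 * T + 2 * T) (cost (canonical n)) (17 * (n * n) + n) (begin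
  cost (canonical n) + (2 * T + 2 * T)
    ≡⟨ cong (λ t → cost (canonical n) + (2 * t + 2 * t)) vertexPositions ⟨
  cost (canonical n) + (2 * (centrePos + outerPositions) + 2 * (centrePos + outerPositions))
    ≡⟨ cong (λ t → cost (canonical n) + (2 * t + 2 * (centrePos + outerPositions))) centre-first ⟨
  cost (canonical n) + (2 * (n * centrePos + outerPositions) + 2 * (centrePos + outerPositions))
    ≡⟨ cost-identity ⟩
  2 * triangular (1 + n * 2 + n * 3)
    ≡⟨ 2*triangular[1+5n] n ⟩
  17 * (n * n) + n + (2 * T + 2 * T) ∎)
  where
  open ≡-Reasoning
  open FriendshipCSeq (canonical n)
  T = triangular (1 + n * 2)
  vertexPositions : centrePos + outerPositions ≡ T
  vertexPositions = trans (sym (∑-vertexEnum n (pos (canonical n) ∘ inj₁)))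
                          (vertices-first-vertexPositions {Friendship n} (vertexEnum n) (edgeEnum n))
  -- centrePos reduces to 0: the centre is listed first.
  centre-first : n * centrePos + outerPositions ≡ centrePos + outerPositions
  centre-first = cong (_+ outerPositions) (*-zeroʳ n)

cost≤17n²+n : ∀ {n ℓ} → 1 ≤ n → (s : CSeq (Friendship n) ℓ) → cost s ≤ 17 * (n * n) + n
cost≤17n²+n {n} 1≤n s = +-cancelʳ-≤ (2 * T + 2 * T) (cost s) (17 * (n * n) + n) (begin
  cost s + (2 * T + 2 * T)
    ≤⟨ +-monoʳ-≤ (cost s) (+-mono-≤ (*-monoʳ-≤ 2 (≤-trans triangular≤vertexPositions centre-weighted))
                                    (*-monoʳ-≤ 2 triangular≤vertexPositions)) ⟩
  cost s + (2 * (n * centrePos + outerPositions) + 2 * (centrePos + outerPositions))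
    ≡⟨ cost-identity ⟩
  2 * triangular (1 + n * 2 + n * 3)
    ≡⟨ 2*triangular[1+5n] n ⟩
  17 * (n * n) + n + (2 * T + 2 * T) ∎)
  where
  open ≤-Reasoning
  open FriendshipCSeq s
  T = triangular (1 + n * 2)
  centre-weighted : centrePos + outerPositions ≤ n * centrePos + outerPositions
  centre-weighted = +-monoˡ-≤ outerPositions (m≤n*m centrePos n {{>-nonZero 1≤n}})

theorem15 : ∀ (n : ℕ) → 1 ≤ n → MaxCost (Friendship n) (17 * (n * n) + n)
theorem15 n 1≤n = (1 + n * 2 + n * 3 , canonical n , cost-canonical≡17n²+n n) , λ ℓ → cost≤17n²+n 1≤n
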